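{- For any two nonnegative integers $n, p$, $$\sum_{k=0}^n \binom{n}{k}\frac{s(k+1,p)}{(k+1)!} \;=\; (-1)^{p-1}(-1)^n\,\frac{s(n+1,p)}{(n+1)!}.$$
   Context: $s(n,k)$ denotes the (signed) Stirling numbers of the first kind, defined by $\frac{1}{p!}\ln^p(1+x) = \sum_{n\ge 0} s(n,p)\frac{x^n}{n!}$; in particular $s(0,0)=1$, $s(n,0)=0$ for $n\ge1$, and $s(n,p)=0$ for $n<p$. -}

module Defs where

open import Data.Nat using (ℕ; zero; suc)
open import Data.Integer using (ℤ; +_; -_; _-_; _*_)
open import Data.Rational using (ℚ; _/_; _÷_; 0ℚ; 1ℚ)
import Data.Rational as Q
open import Data.Nat.Combinatorics using (_C_)
open import Data.Nat.Base using (_!)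
open import Data.Nat.Properties using (_!≢0)

-- These are the coefficients of the falling factorial x(x-1)...(x-n+1),
-- equivalently the ones defined by (1/p!) ln^p(1+x) = Σ s(n,p) x^n/n!.
stirling1 : ℕ → ℕ → ℤ
stirling1 zero    zero    = + 1
stirling1 zero    (suc k) = + 0
stirling1 (suc n) zero    = + 0
stirling1 (suc n) (suc k) = stirling1 n k - (+ n) * stirling1 n (suc k)

signQ : ℕ → ℚ
signQ zero    = 1ℚ
signQ (suc m) = Q.- signQ m

stirFrac : ℕ → ℕ → ℚ
stirFrac n p = (stirling1 n p / (n !)) {{n !≢0}}

sumTo : ℕ → (ℕ → ℚ) → ℚ
sumTo zero    f = 0ℚ
sumTo (suc m) f = sumTo m f Q.+ f m

{-# OPTIONS --safe #-}
module Submission where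

-- Write a(m, p) = s(m, p) / m!.  Dividing s(m+1, p+1) = s(m, p) − m s(m, p+1) by (m+1)! gives
--   a(m, p) = m a(m, p+1) + (m+1) a(m+1, p+1).
-- Together with Pascal's rule and the absorption identity (k+1) C(n+1, k+1) = (n+1) C(n, k),
-- this makes both X(n, p) = Σₖ C(n, k) a(k+1, p) and X(n, p) = (−1)^(p+1) (−1)^n a(n+1, p)
-- solutions of
--   (n+2) X(n+1, p+1) = (n+1) X(n, p+1) + X(n, p).
-- Both vanish at p = 0 and agree at n = 0 (as s(1, p) = [p = 1]); the recurrence determines
-- all other values from these.

module BinomialCoefficients where

  open import Data.Nat using (ℕ; zero; suc; _+_; _*_)
  open import Data.Nat.Properties using (+-assoc; +-comm; +-identityʳ; *-identityʳ; *-zeroʳ; *-distribˡ-+)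
  open import Data.Nat.Combinatorics using (_C_; nC1≡n; nCk+nC[k+1]≡[n+1]C[k+1])
  open import Relation.Binary.PropositionalEquality
    using (_≡_; refl; sym; trans; cong; cong₂; module ≡-Reasoning)
  open ≡-Reasoning

  [1+k]*[1+n]C[1+k]≡[1+n]*nCk : ∀ n k → suc k * (suc n C suc k) ≡ suc n * (n C k)
  [1+k]*[1+n]C[1+k]≡[1+n]*nCk zero    zero    = refl
  [1+k]*[1+n]C[1+k]≡[1+n]*nCk zero    (suc k) = *-zeroʳ (suc (suc k))
  [1+k]*[1+n]C[1+k]≡[1+n]*nCk (suc n) zero    =
    trans (+-identityʳ _) (trans (nC1≡n (suc (suc n))) (sym (*-identityʳ (suc (suc n)))))
  [1+k]*[1+n]C[1+k]≡[1+n]*nCk (suc n) (suc k) = begin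
    suc (suc k) * (suc (suc n) C suc (suc k))
      ≡⟨ cong (suc (suc k) *_) (nCk+nC[k+1]≡[n+1]C[k+1] (suc n) (suc k)) ⟨
    suc (suc k) * (c + suc n C suc (suc k))
      ≡⟨ *-distribˡ-+ (suc (suc k)) c (suc n C suc (suc k)) ⟩
    c + suc k * c + suc (suc k) * (suc n C suc (suc k))
      ≡⟨ cong₂ (λ x y → c + x + y) ([1+k]*[1+n]C[1+k]≡[1+n]*nCk n k)
                                        ([1+k]*[1+n]C[1+k]≡[1+n]*nCk n (suc k)) ⟩
    c + suc n * (n C k) + suc n * (n C suc k)
      ≡⟨ +-assoc c _ _ ⟩
    c + (suc n * (n C k) + suc n * (n C suc k))
      ≡⟨ cong (c +_) (*-distribˡ-+ (suc n) (n C k) (n C suc k)) ⟨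
    c + suc n * (n C k + n C suc k)
      ≡⟨ cong (λ x → c + suc n * x) (nCk+nC[k+1]≡[n+1]C[k+1] n k) ⟩
    suc (suc n) * c
      ∎
    where
    c : ℕ
    c = suc n C suc k

  [1+n]*nCk+[1+k]*[1+n]Ck≡[2+n]*[1+n]Ck :
    ∀ n k → suc n * (n C k) + suc k * (suc n C k) ≡ suc (suc n) * (suc n C k)
  [1+n]*nCk+[1+k]*[1+n]Ck≡[2+n]*[1+n]Ck n k = begin
    suc n * (n C k) + suc k * (suc n C k)
      ≡⟨ +-comm (suc n * (n C k)) _ ⟩
    suc k * (suc n C k) + suc n * (n C k)
      ≡⟨ cong (suc k * (suc n C k) +_) ([1+k]*[1+n]C[1+k]≡[1+n]*nCk n k) ⟨
    suc k * (suc n C k) + suc k * (suc n C suc k)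
      ≡⟨ *-distribˡ-+ (suc k) (suc n C k) (suc n C suc k) ⟨
    suc k * (suc n C k + suc n C suc k)
      ≡⟨ cong (suc k *_) (nCk+nC[k+1]≡[n+1]C[k+1] (suc n) k) ⟩
    suc k * (suc (suc n) C suc k)
      ≡⟨ [1+k]*[1+n]C[1+k]≡[1+n]*nCk (suc n) k ⟩
    suc (suc n) * (suc n C k)
      ∎

-- Kept apart from the statement below, whose unqualified `_+_` is addition on ℕ.
module StirlingBinomialSums where

  open import Defs
  open import Function.Base using (_∘_)
  open import Data.Nat as ℕ using (ℕ; zero; suc; _!)
  open import Data.Nat.Properties using (_!≢0; m*n≢0; n<1+n)
  open import Data.Nat.Combinatorics using (_C_; k>n⇒nCk≡0; nCk+nC[k+1]≡[n+1]C[k+1])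
  open import Data.Integer as ℤ using (ℤ; +_)
  import Data.Integer.Properties as ℤ
  open import Data.Integer.Tactic.RingSolver using (solve-∀)
  open import Data.Rational
    using (ℚ; _+_; _*_; _-_; -_; _/_; 0ℚ; 1ℚ; 1/_; NonZero; fromℚᵘ; toℚᵘ)
  open import Data.Rational.Properties
    using ( fromℚᵘ-cong; toℚᵘ-fromℚᵘ; fromℚᵘ-toℚᵘ; toℚᵘ-homo-+; toℚᵘ-homo-*; toℚᵘ-homo‿-
          ; +-assoc; +-identityˡ; +-identityʳ; *-assoc; *-identityˡ; *-zeroˡ; *-zeroʳ
          ; *-distribˡ-+; *-distribʳ-+; *-inverseˡ; 0/n≡0; pos⇒nonZero; normalize-pos
          ; +-0-commutativeMonoid; *-1-commutativeMonoid )
  open import Data.Rational.Unnormalised as ℚᵘ using (ℚᵘ; mkℚᵘ; *≡*)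
  import Data.Rational.Unnormalised.Properties as ℚᵘ
  open import Data.Rational.Solver using (module +-*-Solver)
  open +-*-Solver using (solve; _:+_; _:*_; :-_; _:-_; _:=_)
  open import Algebra.Bundles using (CommutativeMonoid)
  import Algebra.Properties.CommutativeSemigroup as CommSemigroupProperties
  open CommSemigroupProperties (CommutativeMonoid.commutativeSemigroup +-0-commutativeMonoid)
    using (interchange; x∙yz≈xz∙y)
  open CommSemigroupProperties (CommutativeMonoid.commutativeSemigroup *-1-commutativeMonoid)
    using (x∙yz≈y∙xz)
  open import Relation.Binary.PropositionalEquality
  open ≡-Reasoning
  open BinomialCoefficients

  fromℚᵘ-homo-+ : ∀ x y → fromℚᵘ (x ℚᵘ.+ y) ≡ fromℚᵘ x + fromℚᵘ y
  fromℚᵘ-homo-+ x y = begin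
    fromℚᵘ (x ℚᵘ.+ y)
      ≡⟨ fromℚᵘ-cong (ℚᵘ.+-cong (toℚᵘ-fromℚᵘ x) (toℚᵘ-fromℚᵘ y)) ⟨
    fromℚᵘ (toℚᵘ (fromℚᵘ x) ℚᵘ.+ toℚᵘ (fromℚᵘ y))
      ≡⟨ fromℚᵘ-cong (toℚᵘ-homo-+ (fromℚᵘ x) (fromℚᵘ y)) ⟨
    fromℚᵘ (toℚᵘ (fromℚᵘ x + fromℚᵘ y))
      ≡⟨ fromℚᵘ-toℚᵘ (fromℚᵘ x + fromℚᵘ y) ⟩
    fromℚᵘ x + fromℚᵘ y
      ∎

  fromℚᵘ-homo-* : ∀ x y → fromℚᵘ (x ℚᵘ.* y) ≡ fromℚᵘ x * fromℚᵘ y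
  fromℚᵘ-homo-* x y = begin
    fromℚᵘ (x ℚᵘ.* y)
      ≡⟨ fromℚᵘ-cong (ℚᵘ.*-cong (toℚᵘ-fromℚᵘ x) (toℚᵘ-fromℚᵘ y)) ⟨
    fromℚᵘ (toℚᵘ (fromℚᵘ x) ℚᵘ.* toℚᵘ (fromℚᵘ y))
      ≡⟨ fromℚᵘ-cong (toℚᵘ-homo-* (fromℚᵘ x) (fromℚᵘ y)) ⟨
    fromℚᵘ (toℚᵘ (fromℚᵘ x * fromℚᵘ y))
      ≡⟨ fromℚᵘ-toℚᵘ (fromℚᵘ x * fromℚᵘ y) ⟩
    fromℚᵘ x * fromℚᵘ y
      ∎

  fromℚᵘ-homo‿- : ∀ x → fromℚᵘ (ℚᵘ.- x) ≡ - fromℚᵘ x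
  fromℚᵘ-homo‿- x = begin
    fromℚᵘ (ℚᵘ.- x)                 ≡⟨ fromℚᵘ-cong (ℚᵘ.-‿cong (toℚᵘ-fromℚᵘ x)) ⟨
    fromℚᵘ (ℚᵘ.- toℚᵘ (fromℚᵘ x))   ≡⟨ fromℚᵘ-cong (toℚᵘ-homo‿- (fromℚᵘ x)) ⟨
    fromℚᵘ (toℚᵘ (- fromℚᵘ x))      ≡⟨ fromℚᵘ-toℚᵘ (- fromℚᵘ x) ⟩
    - fromℚᵘ x                      ∎

  -- `fromℕ m` and `z / suc e` unfold to `fromℚᵘ (mkℚᵘ (+ m) 0)` and `fromℚᵘ (mkℚᵘ z e)`, so the
  -- identities below are cross-multiplied in ℤ and transported along `fromℚᵘ`.
  fromℕ : ℕ → ℚ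
  fromℕ m = + m / 1

  fromℕ-homo-+ : ∀ a b → fromℕ (a ℕ.+ b) ≡ fromℕ a + fromℕ b
  fromℕ-homo-+ a b = begin
    fromℚᵘ x
      ≡⟨ fromℚᵘ-cong {x} {y} (*≡* (trans (cong (ℤ._* + 1) (ℤ.pos-+ a b)) (cross (+ a) (+ b)))) ⟩
    fromℚᵘ y
      ≡⟨ fromℚᵘ-homo-+ (mkℚᵘ (+ a) 0) (mkℚᵘ (+ b) 0) ⟩
    fromℕ a + fromℕ b
      ∎
    where
    x y : ℚᵘ
    x = mkℚᵘ (+ (a ℕ.+ b)) 0
    y = mkℚᵘ (+ a) 0 ℚᵘ.+ mkℚᵘ (+ b) 0
    cross : ∀ i j → (i ℤ.+ j) ℤ.* + 1 ≡ (i ℤ.* + 1 ℤ.+ j ℤ.* + 1) ℤ.* + 1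
    cross = solve-∀

  fromℕ-homo-* : ∀ a b → fromℕ (a ℕ.* b) ≡ fromℕ a * fromℕ b
  fromℕ-homo-* a b = begin
    fromℚᵘ x
      ≡⟨ fromℚᵘ-cong {x} {y} (*≡* (cong (ℤ._* + 1) (ℤ.pos-* a b))) ⟩
    fromℚᵘ y
      ≡⟨ fromℚᵘ-homo-* (mkℚᵘ (+ a) 0) (mkℚᵘ (+ b) 0) ⟩
    fromℕ a * fromℕ b
      ∎
    where
    x y : ℚᵘ
    x = mkℚᵘ (+ (a ℕ.* b)) 0
    y = mkℚᵘ (+ a) 0 ℚᵘ.* mkℚᵘ (+ b) 0

  fromℕ-*-assoc : ∀ a b x → fromℕ a * (fromℕ b * x) ≡ fromℕ (a ℕ.* b) * x
  fromℕ-*-assoc a b x =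
    trans (sym (*-assoc (fromℕ a) (fromℕ b) x)) (cong (_* x) (sym (fromℕ-homo-* a b)))

  fromℕ-combination : ∀ a b c d e g → a ℕ.* b ℕ.+ c ℕ.* d ≡ e ℕ.* g → ∀ x →
                      fromℕ a * (fromℕ b * x) + fromℕ c * (fromℕ d * x) ≡ fromℕ e * (fromℕ g * x)
  fromℕ-combination a b c d e g ab+cd≡eg x = begin
    fromℕ a * (fromℕ b * x) + fromℕ c * (fromℕ d * x)
      ≡⟨ cong₂ _+_ (fromℕ-*-assoc a b x) (fromℕ-*-assoc c d x) ⟩
    fromℕ (a ℕ.* b) * x + fromℕ (c ℕ.* d) * x
      ≡⟨ *-distribʳ-+ x (fromℕ (a ℕ.* b)) (fromℕ (c ℕ.* d)) ⟨
    (fromℕ (a ℕ.* b) + fromℕ (c ℕ.* d)) * x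
      ≡⟨ cong (_* x) (fromℕ-homo-+ (a ℕ.* b) (c ℕ.* d)) ⟨
    fromℕ (a ℕ.* b ℕ.+ c ℕ.* d) * x
      ≡⟨ cong (λ n → fromℕ n * x) ab+cd≡eg ⟩
    fromℕ (e ℕ.* g) * x
      ≡⟨ fromℕ-*-assoc e g x ⟨
    fromℕ e * (fromℕ g * x)
      ∎

  [1+m]*[z/[1+m]*d]≡z/d : ∀ m d .{{_ : ℕ.NonZero d}} z →
                          fromℕ (suc m) * (z / (suc m ℕ.* d)) {{m*n≢0 (suc m) d}} ≡ z / d
  [1+m]*[z/[1+m]*d]≡z/d m (suc e) z = begin
    fromℚᵘ (mkℚᵘ (+ suc m) 0) * fromℚᵘ x
      ≡⟨ fromℚᵘ-homo-* (mkℚᵘ (+ suc m) 0) x ⟨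
    fromℚᵘ y
      ≡⟨ fromℚᵘ-cong {y} {mkℚᵘ z e} (*≡* (cross (+ suc m) z (+ suc e))) ⟩
    fromℚᵘ (mkℚᵘ z e)
      ∎
    where
    x y : ℚᵘ
    x = mkℚᵘ z (e ℕ.+ m ℕ.* suc e)
    y = mkℚᵘ (+ suc m) 0 ℚᵘ.* x
    cross : ∀ i j k → (i ℤ.* j) ℤ.* k ≡ j ℤ.* (+ 1 ℤ.* (i ℤ.* k))
    cross = solve-∀

  [u-v]/d≡u/d-v/d : ∀ d .{{_ : ℕ.NonZero d}} u v → (u ℤ.- v) / d ≡ u / d - v / d
  [u-v]/d≡u/d-v/d (suc e) u v = begin
    fromℚᵘ (mkℚᵘ (u ℤ.- v) e)
      ≡⟨ fromℚᵘ-cong {mkℚᵘ (u ℤ.- v) e} {x ℚᵘ.- y} (*≡* (cross u v (+ suc e))) ⟩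
    fromℚᵘ (x ℚᵘ.+ ℚᵘ.- y)
      ≡⟨ fromℚᵘ-homo-+ x (ℚᵘ.- y) ⟩
    fromℚᵘ x + fromℚᵘ (ℚᵘ.- y)
      ≡⟨ cong (_+_ (fromℚᵘ x)) (fromℚᵘ-homo‿- y) ⟩
    fromℚᵘ x - fromℚᵘ y
      ∎
    where
    x y : ℚᵘ
    x = mkℚᵘ u e
    y = mkℚᵘ v e
    cross : ∀ i j k → (i ℤ.- j) ℤ.* (k ℤ.* k) ≡ (i ℤ.* k ℤ.+ ℤ.- j ℤ.* k) ℤ.* k
    cross = solve-∀

  [m*v]/d≡m*[v/d] : ∀ m d .{{_ : ℕ.NonZero d}} v → (+ m ℤ.* v) / d ≡ fromℕ m * (v / d)
  [m*v]/d≡m*[v/d] m (suc e) v = begin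
    fromℚᵘ (mkℚᵘ (+ m ℤ.* v) e)
      ≡⟨ fromℚᵘ-cong {mkℚᵘ (+ m ℤ.* v) e} {y} (*≡* (cross (+ m) v (+ suc e))) ⟩
    fromℚᵘ y
      ≡⟨ fromℚᵘ-homo-* (mkℚᵘ (+ m) 0) (mkℚᵘ v e) ⟩
    fromℕ m * fromℚᵘ (mkℚᵘ v e)
      ∎
    where
    y : ℚᵘ
    y = mkℚᵘ (+ m) 0 ℚᵘ.* mkℚᵘ v e
    cross : ∀ i j k → (i ℤ.* j) ℤ.* (+ 1 ℤ.* k) ≡ (i ℤ.* j) ℤ.* k
    cross = solve-∀

  *-cancelˡ-≡ : ∀ r .{{_ : NonZero r}} {p q} → r * p ≡ r * q → p ≡ q
  *-cancelˡ-≡ r {p} {q} eq = begin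
    p                ≡⟨ *-identityˡ p ⟨
    1ℚ * p           ≡⟨ cong (_* p) (*-inverseˡ r) ⟨
    1/ r * r * p     ≡⟨ *-assoc (1/ r) r p ⟩
    1/ r * (r * p)   ≡⟨ cong (1/ r *_) eq ⟩
    1/ r * (r * q)   ≡⟨ *-assoc (1/ r) r q ⟨
    1/ r * r * q     ≡⟨ cong (_* q) (*-inverseˡ r) ⟩
    1ℚ * q           ≡⟨ *-identityˡ q ⟩
    q                ∎

  fromℕ-suc-nonZero : ∀ m → NonZero (fromℕ (suc m))
  fromℕ-suc-nonZero m = pos⇒nonZero (fromℕ (suc m)) {{normalize-pos (suc m) 1}}

  sumTo-cong : ∀ m {f g : ℕ → ℚ} → (∀ k → f k ≡ g k) → sumTo m f ≡ sumTo m g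
  sumTo-cong zero    f≗g = refl
  sumTo-cong (suc m) f≗g = cong₂ _+_ (sumTo-cong m f≗g) (f≗g m)

  sumTo-+ : ∀ m (f g : ℕ → ℚ) → sumTo m (λ k → f k + g k) ≡ sumTo m f + sumTo m g
  sumTo-+ zero    f g = sym (+-identityˡ 0ℚ)
  sumTo-+ (suc m) f g = trans (cong (_+ (f m + g m)) (sumTo-+ m f g))
                              (interchange (sumTo m f) (sumTo m g) (f m) (g m))

  sumTo-*ˡ : ∀ m c (f : ℕ → ℚ) → sumTo m (λ k → c * f k) ≡ c * sumTo m f
  sumTo-*ˡ zero    c f = sym (*-zeroʳ c)
  sumTo-*ˡ (suc m) c f = trans (cong (_+ c * f m) (sumTo-*ˡ m c f))
                               (sym (*-distribˡ-+ c (sumTo m f) (f m)))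

  sumTo-suc-shift : ∀ m (f : ℕ → ℚ) → sumTo (suc m) f ≡ f 0 + sumTo m (f ∘ suc)
  sumTo-suc-shift zero    f = trans (+-identityˡ (f 0)) (sym (+-identityʳ (f 0)))
  sumTo-suc-shift (suc m) f = trans (cong (_+ f (suc m)) (sumTo-suc-shift m f))
                                    (+-assoc (f 0) (sumTo m (f ∘ suc)) (f (suc m)))

  sumTo-zero : ∀ m {f : ℕ → ℚ} → (∀ k → f k ≡ 0ℚ) → sumTo m f ≡ 0ℚ
  sumTo-zero zero    f≗0 = refl
  sumTo-zero (suc m) f≗0 = cong₂ _+_ (sumTo-zero m f≗0) (f≗0 m)

  binomialSum : ℕ → (ℕ → ℚ) → ℚ
  binomialSum n f = sumTo (suc n) (λ k → fromℕ (n C k) * f k)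

  binomialSum-cong : ∀ n {f g : ℕ → ℚ} → (∀ k → f k ≡ g k) → binomialSum n f ≡ binomialSum n g
  binomialSum-cong n f≗g = sumTo-cong (suc n) (λ k → cong (fromℕ (n C k) *_) (f≗g k))

  binomialSum-+ : ∀ n (f g : ℕ → ℚ) →
                  binomialSum n (λ k → f k + g k) ≡ binomialSum n f + binomialSum n g
  binomialSum-+ n f g =
    trans (sumTo-cong (suc n) (λ k → *-distribˡ-+ (fromℕ (n C k)) (f k) (g k)))
          (sumTo-+ (suc n) (λ k → fromℕ (n C k) * f k) (λ k → fromℕ (n C k) * g k))

  binomialSum-pad : ∀ n (f : ℕ → ℚ) →
                    sumTo (suc (suc n)) (λ k → fromℕ (n C k) * f k) ≡ binomialSum n f
  binomialSum-pad n f = begin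
    binomialSum n f + fromℕ (n C suc n) * f (suc n)
      ≡⟨ cong (λ c → binomialSum n f + fromℕ c * f (suc n)) (k>n⇒nCk≡0 (n<1+n n)) ⟩
    binomialSum n f + 0ℚ * f (suc n)
      ≡⟨ cong (_+_ (binomialSum n f)) (*-zeroˡ (f (suc n))) ⟩
    binomialSum n f + 0ℚ
      ≡⟨ +-identityʳ (binomialSum n f) ⟩
    binomialSum n f
      ∎

  binomialSum-pascal : ∀ n (g : ℕ → ℚ) →
                       binomialSum (suc n) g ≡ binomialSum n (λ k → g k + g (suc k))
  binomialSum-pascal n g = begin
    binomialSum (suc n) g
      ≡⟨ sumTo-suc-shift (suc n) (λ k → fromℕ (suc n C k) * g k) ⟩
    g₀ + sumTo (suc n) (λ k → fromℕ (suc n C suc k) * g (suc k))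
      ≡⟨ cong (_+_ g₀) (trans (sumTo-cong (suc n) pascal) (sumTo-+ (suc n) _ _)) ⟩
    g₀ + (binomialSum n (g ∘ suc) + tail)
      ≡⟨ x∙yz≈xz∙y g₀ (binomialSum n (g ∘ suc)) tail ⟩
    g₀ + tail + binomialSum n (g ∘ suc)
      ≡⟨ cong (_+ binomialSum n (g ∘ suc)) (sumTo-suc-shift (suc n) (λ k → fromℕ (n C k) * g k)) ⟨
    sumTo (suc (suc n)) (λ k → fromℕ (n C k) * g k) + binomialSum n (g ∘ suc)
      ≡⟨ cong (_+ binomialSum n (g ∘ suc)) (binomialSum-pad n g) ⟩
    binomialSum n g + binomialSum n (g ∘ suc)
      ≡⟨ binomialSum-+ n g (g ∘ suc) ⟨
    binomialSum n (λ k → g k + g (suc k))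
      ∎
    where
    g₀ tail : ℚ
    -- it also stands for `fromℕ (suc n C 0) * g 0`: both coefficients compute to 1
    g₀ = fromℕ (n C 0) * g 0
    tail = sumTo (suc n) (λ k → fromℕ (n C suc k) * g (suc k))
    pascal : ∀ k → fromℕ (suc n C suc k) * g (suc k)
                   ≡ fromℕ (n C k) * g (suc k) + fromℕ (n C suc k) * g (suc k)
    pascal k = begin
      fromℕ (suc n C suc k) * g (suc k)
        ≡⟨ cong (λ c → fromℕ c * g (suc k)) (nCk+nC[k+1]≡[n+1]C[k+1] n k) ⟨
      fromℕ (n C k ℕ.+ n C suc k) * g (suc k)
        ≡⟨ cong (_* g (suc k)) (fromℕ-homo-+ (n C k) (n C suc k)) ⟩
      (fromℕ (n C k) + fromℕ (n C suc k)) * g (suc k)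
        ≡⟨ *-distribʳ-+ (g (suc k)) (fromℕ (n C k)) (fromℕ (n C suc k)) ⟩
      fromℕ (n C k) * g (suc k) + fromℕ (n C suc k) * g (suc k)
        ∎

  stirFrac-zero : ∀ m → stirFrac (suc m) 0 ≡ 0ℚ
  stirFrac-zero m = 0/n≡0 (suc m !) {{suc m !≢0}}

  stirFrac-recurrence : ∀ m p → stirFrac m p ≡
    fromℕ m * stirFrac m (suc p) + fromℕ (suc m) * stirFrac (suc m) (suc p)
  -- `stirFrac (suc m) (suc p)` unfolds to `(u ℤ.- + m ℤ.* v) / (suc m ℕ.* m !)`
  stirFrac-recurrence m p = sym (begin
    fromℕ m * b + fromℕ (suc m) * stirFrac (suc m) (suc p)
      ≡⟨ cong (_+_ (fromℕ m * b)) ([1+m]*[z/[1+m]*d]≡z/d m (m !) (u ℤ.- + m ℤ.* v)) ⟩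
    fromℕ m * b + (u ℤ.- + m ℤ.* v) / m !
      ≡⟨ cong (_+_ (fromℕ m * b)) ([u-v]/d≡u/d-v/d (m !) u (+ m ℤ.* v)) ⟩
    fromℕ m * b + (u / m ! - (+ m ℤ.* v) / m !)
      ≡⟨ cong (λ w → fromℕ m * b + (u / m ! - w)) ([m*v]/d≡m*[v/d] m (m !) v) ⟩
    fromℕ m * b + (u / m ! - fromℕ m * b)
      ≡⟨ solve 2 (λ x y → y :+ (x :- y) := x) refl (u / m !) (fromℕ m * b) ⟩
    u / m !
      ∎)
    where
    instance
      m!≢0 : ℕ.NonZero (m !)
      m!≢0 = m !≢0
    u v : ℤ
    u = stirling1 m p
    v = stirling1 m (suc p)
    b : ℚ
    b = v / m !

  Recurrence : (ℕ → ℕ → ℚ) → Set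
  Recurrence X = ∀ n p →
    fromℕ (suc (suc n)) * X (suc n) (suc p) ≡ fromℕ (suc n) * X n (suc p) + X n p

  recurrence-unique : ∀ {X Y} → Recurrence X → Recurrence Y →
                      (∀ n → X n 0 ≡ Y n 0) → (∀ p → X 0 (suc p) ≡ Y 0 (suc p)) →
                      ∀ n p → X n p ≡ Y n p
  recurrence-unique recX recY eq₀ eq₁ n       zero    = eq₀ n
  recurrence-unique recX recY eq₀ eq₁ zero    (suc p) = eq₁ p
  recurrence-unique {X} {Y} recX recY eq₀ eq₁ (suc n) (suc p) =
    *-cancelˡ-≡ (fromℕ (suc (suc n))) {{fromℕ-suc-nonZero (suc n)}} (begin
      fromℕ (suc (suc n)) * X (suc n) (suc p)  ≡⟨ recX n p ⟩
      fromℕ (suc n) * X n (suc p) + X n p      ≡⟨ cong₂ (λ x y → fromℕ (suc n) * x + y) (agree n (suc p)) (agree n p) ⟩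
      fromℕ (suc n) * Y n (suc p) + Y n p      ≡⟨ recY n p ⟨
      fromℕ (suc (suc n)) * Y (suc n) (suc p)  ∎)
    where
    agree : ∀ n p → X n p ≡ Y n p
    agree = recurrence-unique recX recY eq₀ eq₁

  signedStirFrac : ℕ → ℕ → ℚ
  signedStirFrac n p = signQ (p ℕ.+ 1) * signQ n * stirFrac (suc n) p

  signedStirFrac-recurrence : Recurrence signedStirFrac
  -- The signs of `signedStirFrac (suc n) (suc p)` and `signedStirFrac n (suc p)` unfold to
  -- `- σ * - τ` and `- σ * τ`.
  signedStirFrac-recurrence n p = begin
    i * (- σ * - τ * a)
      ≡⟨ solve 6 (λ σ τ i j a b → i :* (:- σ :* :- τ :* a) := j :* (:- σ :* τ :* b) :+ σ :* τ :* (j :* b :+ i :* a))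
               refl σ τ i j a b ⟩
    j * (- σ * τ * b) + σ * τ * (j * b + i * a)
      ≡⟨ cong (λ s → j * (- σ * τ * b) + σ * τ * s) (stirFrac-recurrence (suc n) p) ⟨
    j * (- σ * τ * b) + σ * τ * stirFrac (suc n) p
      ∎
    where
    σ τ i j a b : ℚ
    σ = signQ (p ℕ.+ 1)
    τ = signQ n
    i = fromℕ (suc (suc n))
    j = fromℕ (suc n)
    a = stirFrac (suc (suc n)) (suc p)
    b = stirFrac (suc n) (suc p)

  stirlingBinomialSum : ℕ → ℕ → ℚ
  stirlingBinomialSum n p = binomialSum n (λ k → stirFrac (suc k) p)

  stirlingBinomialSum-recurrence : Recurrence stirlingBinomialSum
  stirlingBinomialSum-recurrence n p = begin
    i * binomialSum (suc n) f
      ≡⟨ sumTo-*ˡ (suc (suc n)) i (λ k → fromℕ (suc n C k) * f k) ⟨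
    sumTo (suc (suc n)) (λ k → i * (fromℕ (suc n C k) * f k))
      ≡⟨ sumTo-cong (suc (suc n)) coefficients ⟨
    sumTo (suc (suc n)) (λ k → j * (fromℕ (n C k) * f k) + fromℕ (suc n C k) * g k)
      ≡⟨ sumTo-+ (suc (suc n)) (λ k → j * (fromℕ (n C k) * f k)) (λ k → fromℕ (suc n C k) * g k) ⟩
    sumTo (suc (suc n)) (λ k → j * (fromℕ (n C k) * f k)) + binomialSum (suc n) g
      ≡⟨ cong₂ _+_ (trans (sumTo-*ˡ (suc (suc n)) j (λ k → fromℕ (n C k) * f k))
                          (cong (j *_) (binomialSum-pad n f)))
                   (binomialSum-pascal n g) ⟩
    j * binomialSum n f + binomialSum n (λ k → g k + g (suc k))
      ≡⟨ cong (_+_ (j * binomialSum n f)) (binomialSum-cong n (λ k → stirFrac-recurrence (suc k) p)) ⟨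
    j * binomialSum n f + stirlingBinomialSum n p
      ∎
    where
    i j : ℚ
    i = fromℕ (suc (suc n))
    j = fromℕ (suc n)
    f g : ℕ → ℚ
    f k = stirFrac (suc k) (suc p)
    g k = fromℕ (suc k) * f k
    coefficients : ∀ k → j * (fromℕ (n C k) * f k) + fromℕ (suc n C k) * g k
                         ≡ i * (fromℕ (suc n C k) * f k)
    coefficients k = begin
      j * (fromℕ (n C k) * f k) + fromℕ (suc n C k) * (fromℕ (suc k) * f k)
        ≡⟨ cong (_+_ (j * (fromℕ (n C k) * f k))) (x∙yz≈y∙xz (fromℕ (suc n C k)) (fromℕ (suc k)) (f k)) ⟩
      j * (fromℕ (n C k) * f k) + fromℕ (suc k) * (fromℕ (suc n C k) * f k)
        ≡⟨ fromℕ-combination (suc n) (n C k) (suc k) (suc n C k) (suc (suc n)) (suc n C k)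
                             ([1+n]*nCk+[1+k]*[1+n]Ck≡[2+n]*[1+n]Ck n k) (f k) ⟩
      i * (fromℕ (suc n C k) * f k)
        ∎

  stirlingBinomialSum-zero : ∀ n → stirlingBinomialSum n 0 ≡ 0ℚ
  stirlingBinomialSum-zero n = sumTo-zero (suc n) (λ k →
    trans (cong (fromℕ (n C k) *_) (stirFrac-zero k)) (*-zeroʳ (fromℕ (n C k))))

  signedStirFrac-zero : ∀ n → signedStirFrac n 0 ≡ 0ℚ
  signedStirFrac-zero n =
    trans (cong (signQ 1 * signQ n *_) (stirFrac-zero n)) (*-zeroʳ (signQ 1 * signQ n))

open import Defs
open import Data.Nat using (ℕ; zero; suc; _+_)
open import Data.Nat.Combinatorics using (_C_)
open import Data.Integer using (+_)
open import Data.Rational using (ℚ; _*_; _/_)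
open import Data.Rational.Properties using (*-zeroʳ)
open import Relation.Binary.PropositionalEquality using (_≡_; refl; sym; trans)
open StirlingBinomialSums

proposition4 : (n p : ℕ) →
    sumTo (suc n) (λ k → ((+ (n C k)) / 1) * stirFrac (suc k) p)
      ≡ signQ (p + 1) * signQ n * stirFrac (suc n) p
proposition4 = recurrence-unique stirlingBinomialSum-recurrence signedStirFrac-recurrence vanish base
  where
  vanish : ∀ n → stirlingBinomialSum n 0 ≡ signedStirFrac n 0
  vanish n = trans (stirlingBinomialSum-zero n) (sym (signedStirFrac-zero n))

  -- s(1, 1) = 1 and s(1, p + 2) = 0
  base : ∀ p → stirlingBinomialSum 0 (suc p) ≡ signedStirFrac 0 (suc p)
  base zero    = refl
  base (suc p) = sym (*-zeroʳ (signQ (suc (suc p) + 1) * signQ 0))
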